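{- For every positive integer $k$, there exists a group divisible triangle design $(V,\mathcal{G},\mathcal{B})$ of order $6k$ with groups of dimension $6$ over $\mathbb{F}_2$, where $V$ is a $k$-dimensional vector space over $\mathbb{F}_{2^6}$ (viewed as a $6k$-dimensional vector space over $\mathbb{F}_2$) and $\mathcal{G}$ is the set of all $1$-dimensional $\mathbb{F}_{2^6}$-subspaces of $V$.
   Context: For a vector space $V$ over $\mathbb{F}_q$, a triangle is a set $\{\langle a,b\rangle,\langle b,c\rangle,\langle c,a\rangle\}$ of three $2$-dimensional $\mathbb{F}_q$-subspaces, where $a,b,c\in V$ are linearly independent over $\mathbb{F}_q$. Let $m$ divide $n$. A group divisible triangle design of order $n$ with groups of dimension $m$ over $\mathbb{F}_q$ is a triple $(V,\mathcal{G},\mathcal{B})$, where $V$ is an $n$-dimensional vector space over $\mathbb{F}_q$, $\mathcal{G}$ is a set of $m$-dimensional subspaces of $V$ (groups) such that every nonzero vector of $V$ lies in exactly one of them, and $\mathcal{B}$ is a set of triangles in $V$, such that every $2$-dimensional $\mathbb{F}_q$-subspace of $V$ either is one of the three subspaces of exactly one triangle in $\mathcal{B}$ and is contained in no group, or belongs to no triangle of $\mathcal{B}$ and is contained in one group. -}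

module Defs where

open import Data.Bool using (Bool; true; false; _xor_; if_then_else_)
open import Data.Nat using (ℕ)
open import Data.Fin using (Fin)
open import Data.Vec using (Vec; []; _∷_; zipWith; replicate; map)
open import Data.List using (List; length; lookup)
open import Data.Product using (Σ; ∃; _×_)
open import Data.Sum using (_⊎_)
open import Relation.Binary.PropositionalEquality using (_≡_; _≢_)
open import Relation.Nullary using (¬_)

-- The prime field F₂ is Bool with xor as addition.
-- The field F₆₄ = F₂[x]/(x⁶ + x + 1)  (x⁶ + x + 1 is irreducible over F₂);
-- an element c₀ + c₁x + … + c₅x⁵ is the vector (c₀ ∷ … ∷ c₅ ∷ []).

F64 : Set
F64 = Vec Bool 6

0F : F64
0F = replicate 6 false

_+F_ : F64 → F64 → F64
_+F_ = zipWith _xor_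

-- multiplication by x, reducing with x⁶ = x + 1
mulX : F64 → F64
mulX (c0 ∷ c1 ∷ c2 ∷ c3 ∷ c4 ∷ c5 ∷ []) =
  c5 ∷ (c0 xor c5) ∷ c1 ∷ c2 ∷ c3 ∷ c4 ∷ []

mulAux : ∀ {n} → Vec Bool n → F64 → F64
mulAux []       b = 0F
mulAux (a ∷ as) b = (if a then b else 0F) +F mulAux as (mulX b)

_*F_ : F64 → F64 → F64
a *F b = mulAux a b

V : ℕ → Set
V k = Vec F64 k

0V : ∀ {k} → V k
0V {k} = replicate k 0F

_⊕_ : ∀ {k} → V k → V k → V k
_⊕_ = zipWith _+F_

_·_ : ∀ {k} → F64 → V k → V k
λ' · v = map (λ' *F_) v

_•_ : ∀ {k} → Bool → V k → V k
e • v = if e then v else 0V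

LinIndep2 : ∀ {k} → V k → V k → Set
LinIndep2 a b = ∀ (e₁ e₂ : Bool) → (e₁ • a) ⊕ (e₂ • b) ≡ 0V →
                  (e₁ ≡ false) × (e₂ ≡ false)

LinIndep3 : ∀ {k} → V k → V k → V k → Set
LinIndep3 a b c = ∀ (e₁ e₂ e₃ : Bool) → ((e₁ • a) ⊕ (e₂ • b)) ⊕ (e₃ • c) ≡ 0V →
                    (e₁ ≡ false) × (e₂ ≡ false) × (e₃ ≡ false)

_∈⟨_,_⟩ : ∀ {k} → V k → V k → V k → Set
x ∈⟨ a , b ⟩ = (x ≡ 0V) ⊎ (x ≡ a) ⊎ (x ≡ b) ⊎ (x ≡ a ⊕ b)

SameSpan : ∀ {k} → V k → V k → V k → V k → Set
SameSpan {k} a b c d = ∀ (x : V k) → (x ∈⟨ a , b ⟩ → x ∈⟨ c , d ⟩) × (x ∈⟨ c , d ⟩ → x ∈⟨ a , b ⟩)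

-- Triangles {⟨a,b⟩, ⟨b,c⟩, ⟨c,a⟩} with a, b, c F₂-linearly independent

record Triangle (k : ℕ) : Set where
  constructor triangle
  field
    a b c : V k
    indep : LinIndep3 a b c

open Triangle public

HasSide : ∀ {k} → Triangle k → V k → V k → Set
HasSide T x y = SameSpan (a T) (b T) x y ⊎ SameSpan (b T) (c T) x y ⊎ SameSpan (c T) (a T) x y

_∈Group_ : ∀ {k} → V k → V k → Set
x ∈Group v = ∃ λ (λ' : F64) → x ≡ λ' · v

InGroup : ∀ {k} → V k → V k → Set
InGroup {k} x y = Σ (V k) λ v → (v ≢ 0V) × (∀ z → z ∈⟨ x , y ⟩ → z ∈Group v)

-- The block set 𝓑 is a list of triangles; "exactly one triangle of 𝓑"
-- means exactly one position of the list (so duplicate entries are excluded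
-- wherever it matters).

ExactlyOne : ∀ {k} → List (Triangle k) → (Triangle k → Set) → Set
ExactlyOne B P = Σ (Fin (length B)) λ i → P (lookup B i) × (∀ j → P (lookup B j) → j ≡ i)

NoneOf : ∀ {k} → List (Triangle k) → (Triangle k → Set) → Set
NoneOf B P = ∀ j → ¬ P (lookup B j)

IsGDTD : ∀ k → List (Triangle k) → Set
IsGDTD k B = ∀ (x y : V k) → LinIndep2 x y →
  ((¬ InGroup x y) × ExactlyOne B (λ T → HasSide T x y))
  ⊎ (InGroup x y × NoneOf B (λ T → HasSide T x y))

-- F64 contains F4 = {0, 1, ω, ω²}, so V = F64ᵏ is also a vector space over F4, and two
-- F64-independent vectors x, y span a 2-dimensional F4-subspace W = F4x + F4y whose F4-lines
-- are its intersections with the groups. On F4² the ten triangles of baseTriangles form a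
-- group divisible triangle design whose groups are the five F4-lines. The blocks are the
-- copies of these triangles in every such plane W, transported along a canonical F4-basis of W
-- (the first suitable vectors in a fixed enumeration of V, so that each plane is used once).
-- A 2-dimensional F2-subspace ⟨x,y⟩ inside a group is a side of no block, since the copies of
-- F4-independent sides are F64-independent. Otherwise x, y are F64-independent, ⟨x,y⟩
-- determines W, and the base design provides exactly one triangle of W with side ⟨x,y⟩.

module Submission where

open import Defs
open import Data.Bool using (Bool; true; false; _xor_; _∧_; if_then_else_)
open import Data.Bool.Properties using (xor-assoc; xor-comm; xor-same) renaming (_≟_ to _≟B_)
open import Data.Empty using (⊥; ⊥-elim)
open import Data.Fin using (Fin; zero; suc) renaming (_≟_ to _≟Fin_)
open import Data.List using (List; []; _∷_; cartesianProduct; cartesianProductWith; allFin; find; lookup)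
open import Data.List.Membership.Propositional using (_∈_; lose)
open import Data.List.Membership.Propositional.Properties using (∈-cartesianProduct⁺; ∈-cartesianProductWith⁺; ∈-allFin)
import Data.List.Relation.Unary.All as All
open import Data.List.Relation.Unary.AllPairs using ([]; _∷_)
import Data.List.Relation.Unary.Any as Any
open import Data.List.Relation.Unary.Any using (here; there)
open import Data.List.Relation.Unary.Unique.Propositional using (Unique)
open import Data.List.Relation.Unary.Unique.Propositional.Properties using (cartesianProduct⁺; cartesianProductWith⁺)
open import Data.Maybe using (fromMaybe)
open import Data.Nat using (ℕ; zero; suc; _≤_)
open import Data.Product using (Σ; _×_; _,_; ∃; ∃₂; proj₁; proj₂; uncurry; map; map₁; swap)
open import Data.Product.Properties using () renaming (≡-dec to ×-≡-dec)
open import Data.Sum using (_⊎_; inj₁; inj₂)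
open import Data.Vec using (Vec; []; _∷_; zipWith; replicate)
import Data.Vec as Vec
open import Data.Vec.Properties using (≡-dec; ∷-injective)
open import Function using (_∘_)
open import Relation.Binary.Definitions using (DecidableEquality)
open import Relation.Binary.PropositionalEquality
open import Relation.Nullary using (¬_; Dec; yes; no; ¬?)
open import Relation.Nullary.Decidable using (from-yes; map′; _→-dec_; _×-dec_; _⊎-dec_)
open import Relation.Unary using (Decidable; _≐_; _⊆_; _∩_; ∁)
open import Relation.Unary.Properties using (_∩?_; ∁?)

private
  variable
    k : ℕ
    l : F64
    u v w x y : V k

record Finite (A : Set) : Set where
  field
    elements : List A
    complete : ∀ a → a ∈ elements

open Finite public

module _ {A : Set} (fin : Finite A) {P : A → Set} where

  all? : Decidable P → Dec (∀ a → P a)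
  all? P? = map′ (λ ps a → All.lookup ps (complete fin a)) (λ ps → All.tabulate λ {a} _ → ps a)
                 (All.all? P? (elements fin))

  any? : Decidable P → Dec (∃ P)
  any? P? = map′ Any.satisfied (λ (a , p) → lose (complete fin a) p) (Any.any? P? (elements fin))

finite-Bool : Finite Bool
finite-Bool = record
  { elements = true ∷ false ∷ []
  ; complete = λ { true → here refl ; false → there (here refl) }
  }

finite-× : ∀ {A B : Set} → Finite A → Finite B → Finite (A × B)
finite-× fa fb = record { elements = cartesianProduct (elements fa) (elements fb)
                        ; complete = λ (a , b) → ∈-cartesianProduct⁺ (complete fa a) (complete fb b) }

finite-Fin : ∀ n → Finite (Fin n)
finite-Fin n = record { elements = allFin n ; complete = ∈-allFin }

vectors : ∀ {A : Set} → List A → ∀ n → List (Vec A n)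
vectors xs zero    = [] ∷ []
vectors xs (suc n) = cartesianProductWith _∷_ xs (vectors xs n)

vectors-complete : ∀ {A : Set} {xs : List A} → (∀ a → a ∈ xs) → ∀ {n} (v : Vec A n) → v ∈ vectors xs n
vectors-complete c []       = here refl
vectors-complete c (a ∷ v) = ∈-cartesianProductWith⁺ _∷_ (c a) (vectors-complete c v)

vectors-unique : ∀ {A : Set} {xs : List A} → Unique xs → ∀ n → Unique (vectors xs n)
vectors-unique u zero    = All.[] ∷ []
vectors-unique u (suc n) = cartesianProductWith⁺ _∷_ ∷-injective u (vectors-unique u n)

finite-Vec : ∀ {A : Set} → Finite A → ∀ n → Finite (Vec A n)
finite-Vec fa n = record { elements = vectors (elements fa) n ; complete = vectors-complete (complete fa) }

module _ {A : Set} {P : A → Set} (P? : Decidable P) (default : A) where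

  find-satisfies : ∀ {a xs} → a ∈ xs → P a → P (fromMaybe default (find P? xs))
  find-satisfies {xs = x ∷ xs} (here refl) pa with P? x
  ... | yes px = px
  ... | no ¬px = ⊥-elim (¬px pa)
  find-satisfies {xs = x ∷ xs} (there a∈xs) pa with P? x
  ... | yes px = px
  ... | no _   = find-satisfies a∈xs pa

find-cong : ∀ {A : Set} {P Q : A → Set} (P? : Decidable P) (Q? : Decidable Q) → P ≐ Q →
            ∀ xs → find P? xs ≡ find Q? xs
find-cong P? Q? P≐Q [] = refl
find-cong P? Q? P≐Q (x ∷ xs) with P? x | Q? x
... | yes _  | yes _  = refl
... | no  _  | no  _  = find-cong P? Q? P≐Q xs
... | yes px | no ¬qx = ⊥-elim (¬qx (proj₁ P≐Q px))
... | no ¬px | yes qx = ⊥-elim (¬px (proj₂ P≐Q qx))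

∩-congˡ : ∀ {A : Set} {S S′ T : A → Set} → S ≐ S′ → (S ∩ T) ≐ (S′ ∩ T)
∩-congˡ (S⊆S′ , S′⊆S) = map₁ S⊆S′ , map₁ S′⊆S

module Collect {A B : Set} {P : A → Set} (P? : Decidable P)
               (key : B → A) (make : ∀ a → P a → B) (key-make : ∀ a pa → key (make a pa) ≡ a) where

  collect : List A → List B
  collect []       = []
  collect (a ∷ as) with P? a
  ... | yes pa = make a pa ∷ collect as
  ... | no  _  = collect as

  collect-sound : ∀ as i → key (lookup (collect as) i) ∈ as × P (key (lookup (collect as) i))
  collect-sound (a ∷ as) i with P? a
  collect-sound (a ∷ as) zero    | yes pa = here (key-make a pa) , subst P (sym (key-make a pa)) pa
  collect-sound (a ∷ as) (suc i) | yes pa = map₁ there (collect-sound as i)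
  collect-sound (a ∷ as) i       | no  _  = map₁ there (collect-sound as i)

  collect-complete : ∀ {a as} → a ∈ as → P a → ∃ λ i → key (lookup (collect as) i) ≡ a
  collect-complete {as = a′ ∷ as} a∈ pa with P? a′
  collect-complete (here refl) pa | yes pa′ = zero , key-make _ pa′
  collect-complete (there a∈) pa  | yes _   = let (i , eq) = collect-complete a∈ pa in suc i , eq
  collect-complete (here refl) pa | no ¬pa  = ⊥-elim (¬pa pa)
  collect-complete (there a∈) pa  | no _    = collect-complete a∈ pa

  collect-injective : ∀ {as} → Unique as → ∀ i j → key (lookup (collect as) i) ≡ key (lookup (collect as) j) → i ≡ j
  collect-injective {a ∷ as} (a∉ ∷ unique) i j eq with P? a
  collect-injective (a∉ ∷ unique) zero    zero    eq | yes pa = refl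
  collect-injective (a∉ ∷ unique) zero    (suc j) eq | yes pa =
    ⊥-elim (All.lookup a∉ (proj₁ (collect-sound _ j)) (trans (sym (key-make _ pa)) eq))
  collect-injective (a∉ ∷ unique) (suc i) zero    eq | yes pa =
    ⊥-elim (All.lookup a∉ (proj₁ (collect-sound _ i)) (trans (sym (key-make _ pa)) (sym eq)))
  collect-injective (a∉ ∷ unique) (suc i) (suc j) eq | yes pa = cong suc (collect-injective unique i j eq)
  collect-injective (a∉ ∷ unique) i       j       eq | no _   = collect-injective unique i j eq

module ZipWith {A : Set} (_∙_ : A → A → A) where

  zipWith-assoc : (∀ a b c → (a ∙ b) ∙ c ≡ a ∙ (b ∙ c)) → ∀ {n} (xs ys zs : Vec A n) →
                  zipWith _∙_ (zipWith _∙_ xs ys) zs ≡ zipWith _∙_ xs (zipWith _∙_ ys zs)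
  zipWith-assoc assoc []       []       []       = refl
  zipWith-assoc assoc (x ∷ xs) (y ∷ ys) (z ∷ zs) = cong₂ _∷_ (assoc x y z) (zipWith-assoc assoc xs ys zs)

  zipWith-comm : (∀ a b → a ∙ b ≡ b ∙ a) → ∀ {n} (xs ys : Vec A n) → zipWith _∙_ xs ys ≡ zipWith _∙_ ys xs
  zipWith-comm comm []       []       = refl
  zipWith-comm comm (x ∷ xs) (y ∷ ys) = cong₂ _∷_ (comm x y) (zipWith-comm comm xs ys)

  zipWith-identityˡ : ∀ e → (∀ a → e ∙ a ≡ a) → ∀ {n} (xs : Vec A n) → zipWith _∙_ (replicate n e) xs ≡ xs
  zipWith-identityˡ e idˡ []       = refl
  zipWith-identityˡ e idˡ (x ∷ xs) = cong₂ _∷_ (idˡ x) (zipWith-identityˡ e idˡ xs)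

  zipWith-self : ∀ e → (∀ a → a ∙ a ≡ e) → ∀ {n} (xs : Vec A n) → zipWith _∙_ xs xs ≡ replicate n e
  zipWith-self e self []       = refl
  zipWith-self e self (x ∷ xs) = cong₂ _∷_ (self x) (zipWith-self e self xs)

module BooleanGroup {A : Set} (_+_ : A → A → A) (0# : A)
  (+-assoc : ∀ a b c → (a + b) + c ≡ a + (b + c))
  (+-comm : ∀ a b → a + b ≡ b + a)
  (+-identityˡ : ∀ a → 0# + a ≡ a)
  (+-self : ∀ a → a + a ≡ 0#) where

  +-identityʳ : ∀ a → a + 0# ≡ a
  +-identityʳ a = trans (+-comm a 0#) (+-identityˡ a)

  +-interchange : ∀ a b c d → (a + b) + (c + d) ≡ (a + c) + (b + d)
  +-interchange a b c d = begin
    (a + b) + (c + d)  ≡⟨ +-assoc a b (c + d) ⟩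
    a + (b + (c + d))  ≡⟨ cong (a +_) (sym (+-assoc b c d)) ⟩
    a + ((b + c) + d)  ≡⟨ cong (λ z → a + (z + d)) (+-comm b c) ⟩
    a + ((c + b) + d)  ≡⟨ cong (a +_) (+-assoc c b d) ⟩
    a + (c + (b + d))  ≡⟨ sym (+-assoc a c (b + d)) ⟩
    (a + c) + (b + d)  ∎
    where open ≡-Reasoning

  x+y≡0⇒x≡y : ∀ a b → a + b ≡ 0# → a ≡ b
  x+y≡0⇒x≡y a b a+b≡0 = begin
    a              ≡⟨ sym (+-identityʳ a) ⟩
    a + 0#         ≡⟨ cong (a +_) (sym (+-self b)) ⟩
    a + (b + b)    ≡⟨ sym (+-assoc a b b) ⟩
    (a + b) + b    ≡⟨ cong (_+ b) a+b≡0 ⟩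
    0# + b         ≡⟨ +-identityˡ b ⟩
    b              ∎
    where open ≡-Reasoning

open ZipWith

+F-assoc : ∀ a b c → (a +F b) +F c ≡ a +F (b +F c)
+F-assoc = zipWith-assoc _xor_ xor-assoc

+F-comm : ∀ a b → a +F b ≡ b +F a
+F-comm = zipWith-comm _xor_ xor-comm

+F-identityˡ : ∀ a → 0F +F a ≡ a
+F-identityˡ = zipWith-identityˡ _xor_ false λ _ → refl

+F-self : ∀ a → a +F a ≡ 0F
+F-self = zipWith-self _xor_ false xor-same

open BooleanGroup _xor_ false xor-assoc xor-comm (λ _ → refl) xor-same
  using () renaming (+-interchange to xor-interchange)

open BooleanGroup _+F_ 0F +F-assoc +F-comm +F-identityˡ +F-self
  using () renaming (+-identityʳ to +F-identityʳ; +-interchange to +F-interchange)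

infix 4 _≟F_
_≟F_ : DecidableEquality F64
_≟F_ = ≡-dec _≟B_

finite-F64 : Finite F64
finite-F64 = finite-Vec finite-Bool 6

1F : F64
1F = true ∷ false ∷ false ∷ false ∷ false ∷ false ∷ []

scale : Bool → F64 → F64
scale a b = if a then b else 0F

mulX-distrib : ∀ a b → mulX (a +F b) ≡ mulX a +F mulX b
mulX-distrib (a0 ∷ a1 ∷ a2 ∷ a3 ∷ a4 ∷ a5 ∷ []) (b0 ∷ b1 ∷ b2 ∷ b3 ∷ b4 ∷ b5 ∷ []) =
  cong (λ c → (a5 xor b5) ∷ c ∷ (a1 xor b1) ∷ (a2 xor b2) ∷ (a3 xor b3) ∷ (a4 xor b4) ∷ [])
       (xor-interchange a0 b0 a5 b5)

scale-distribˡ : ∀ a b c → scale a (b +F c) ≡ scale a b +F scale a c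
scale-distribˡ true  b c = refl
scale-distribˡ false b c = refl

scale-distribʳ : ∀ a b c → scale (a xor b) c ≡ scale a c +F scale b c
scale-distribʳ true  true  c = sym (+F-self c)
scale-distribʳ true  false c = sym (+F-identityʳ c)
scale-distribʳ false true  c = sym (+F-identityˡ c)
scale-distribʳ false false c = refl

mulAux-distribˡ : ∀ {n} (as : Vec Bool n) b c → mulAux as (b +F c) ≡ mulAux as b +F mulAux as c
mulAux-distribˡ []       b c = refl
mulAux-distribˡ (a ∷ as) b c = begin
  scale a (b +F c) +F mulAux as (mulX (b +F c))
    ≡⟨ cong₂ _+F_ (scale-distribˡ a b c)
                  (trans (cong (mulAux as) (mulX-distrib b c)) (mulAux-distribˡ as (mulX b) (mulX c))) ⟩
  (scale a b +F scale a c) +F (mulAux as (mulX b) +F mulAux as (mulX c))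
    ≡⟨ +F-interchange _ _ _ _ ⟩
  (scale a b +F mulAux as (mulX b)) +F (scale a c +F mulAux as (mulX c))  ∎
  where open ≡-Reasoning

mulAux-distribʳ : ∀ {n} (as bs : Vec Bool n) c → mulAux (zipWith _xor_ as bs) c ≡ mulAux as c +F mulAux bs c
mulAux-distribʳ []       []       c = refl
mulAux-distribʳ (a ∷ as) (b ∷ bs) c = begin
  scale (a xor b) c +F mulAux (zipWith _xor_ as bs) (mulX c)
    ≡⟨ cong₂ _+F_ (scale-distribʳ a b c) (mulAux-distribʳ as bs (mulX c)) ⟩
  (scale a c +F scale b c) +F (mulAux as (mulX c) +F mulAux bs (mulX c))
    ≡⟨ +F-interchange _ _ _ _ ⟩
  (scale a c +F mulAux as (mulX c)) +F (scale b c +F mulAux bs (mulX c))  ∎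
  where open ≡-Reasoning

mulAux-zeroˡ : ∀ n c → mulAux (replicate n false) c ≡ 0F
mulAux-zeroˡ zero    c = refl
mulAux-zeroˡ (suc n) c = trans (+F-identityˡ _) (mulAux-zeroˡ n (mulX c))

mulAux-zeroʳ : ∀ {n} (as : Vec Bool n) → mulAux as 0F ≡ 0F
mulAux-zeroʳ []           = refl
mulAux-zeroʳ (true ∷ as)  = trans (+F-identityˡ _) (mulAux-zeroʳ as)
mulAux-zeroʳ (false ∷ as) = trans (+F-identityˡ _) (mulAux-zeroʳ as)

-- Facts about finitely many values are proved by evaluation; they are opaque so that the
-- evaluated proofs are never unfolded.
opaque
  *F-mulXˡ : ∀ b c → mulX b *F c ≡ mulX (b *F c)
  *F-mulXˡ = from-yes (all? finite-F64 λ b → all? finite-F64 λ c → mulX b *F c ≟F mulX (b *F c))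

mulAux-scale : ∀ a b c → mulAux (scale a b) c ≡ scale a (b *F c)
mulAux-scale true  b c = refl
mulAux-scale false b c = mulAux-zeroˡ 6 c

mulAux-assoc : ∀ {n} (as : Vec Bool n) b c → mulAux (mulAux as b) c ≡ mulAux as (b *F c)
mulAux-assoc []       b c = mulAux-zeroˡ 6 c
mulAux-assoc (a ∷ as) b c = begin
  (scale a b +F mulAux as (mulX b)) *F c
    ≡⟨ mulAux-distribʳ (scale a b) (mulAux as (mulX b)) c ⟩
  mulAux (scale a b) c +F mulAux (mulAux as (mulX b)) c
    ≡⟨ cong₂ _+F_ (mulAux-scale a b c) (mulAux-assoc as (mulX b) c) ⟩
  scale a (b *F c) +F mulAux as (mulX b *F c)
    ≡⟨ cong (λ d → scale a (b *F c) +F mulAux as d) (*F-mulXˡ b c) ⟩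
  scale a (b *F c) +F mulAux as (mulX (b *F c))  ∎
  where open ≡-Reasoning

*F-identityˡ : ∀ b → 1F *F b ≡ b
*F-identityˡ b = trans (cong (b +F_) (mulAux-zeroˡ 5 (mulX b))) (+F-identityʳ b)

opaque
  *F-inverse : ∀ a → a ≢ 0F → ∃ λ b → b *F a ≡ 1F
  *F-inverse = from-yes (all? finite-F64 λ a → ¬? (a ≟F 0F) →-dec any? finite-F64 λ b → b *F a ≟F 1F)

⊕-assoc : (u v w : V k) → (u ⊕ v) ⊕ w ≡ u ⊕ (v ⊕ w)
⊕-assoc = zipWith-assoc _+F_ +F-assoc

⊕-comm : (u v : V k) → u ⊕ v ≡ v ⊕ u
⊕-comm = zipWith-comm _+F_ +F-comm

⊕-identityˡ : (v : V k) → 0V ⊕ v ≡ v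
⊕-identityˡ = zipWith-identityˡ _+F_ 0F +F-identityˡ

⊕-self : (v : V k) → v ⊕ v ≡ 0V
⊕-self = zipWith-self _+F_ 0F +F-self

module _ {k : ℕ} where
  open BooleanGroup (_⊕_ {k}) 0V ⊕-assoc ⊕-comm ⊕-identityˡ ⊕-self public
    using () renaming (+-identityʳ to ⊕-identityʳ; +-interchange to ⊕-interchange; x+y≡0⇒x≡y to x⊕y≡0⇒x≡y)

infix 4 _≟V_
_≟V_ : DecidableEquality (V k)
_≟V_ = ≡-dec _≟F_

·-distribˡ : ∀ l (v w : V k) → l · (v ⊕ w) ≡ (l · v) ⊕ (l · w)
·-distribˡ l []      []      = refl
·-distribˡ l (x ∷ v) (y ∷ w) = cong₂ _∷_ (mulAux-distribˡ l x y) (·-distribˡ l v w)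

·-distribʳ : ∀ l m (v : V k) → (l +F m) · v ≡ (l · v) ⊕ (m · v)
·-distribʳ l m []      = refl
·-distribʳ l m (x ∷ v) = cong₂ _∷_ (mulAux-distribʳ l m x) (·-distribʳ l m v)

·-assoc : ∀ l m (v : V k) → (l *F m) · v ≡ l · (m · v)
·-assoc l m []      = refl
·-assoc l m (x ∷ v) = cong₂ _∷_ (mulAux-assoc l m x) (·-assoc l m v)

·-identityˡ : (v : V k) → 1F · v ≡ v
·-identityˡ []      = refl
·-identityˡ (x ∷ v) = cong₂ _∷_ (*F-identityˡ x) (·-identityˡ v)

·-zeroˡ : (v : V k) → 0F · v ≡ 0V
·-zeroˡ []      = refl
·-zeroˡ (x ∷ v) = cong₂ _∷_ (mulAux-zeroˡ 6 x) (·-zeroˡ v)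

·-zeroʳ : ∀ l → l · 0V {k} ≡ 0V
·-zeroʳ {zero}  l = refl
·-zeroʳ {suc k} l = cong₂ _∷_ (mulAux-zeroʳ l) (·-zeroʳ l)

-- F4 inside F64, and the base design on F4²

-- (a , b) stands for a + bω, where ω² = ω + 1.
F4 : Set
F4 = Bool × Bool

0₄ 1₄ ω ω² : F4
0₄ = false , false
1₄ = true  , false
ω  = false , true
ω² = true  , true

infixl 6 _+₄_
infixl 7 _*₄_

_+₄_ : F4 → F4 → F4
(a , b) +₄ (c , d) = a xor c , b xor d

_*₄_ : F4 → F4 → F4
(a , b) *₄ (c , d) = (a ∧ c) xor (b ∧ d) , ((a ∧ d) xor (b ∧ c)) xor (b ∧ d)

infix 4 _≟₄_
_≟₄_ : DecidableEquality F4
_≟₄_ = ×-≡-dec _≟B_ _≟B_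

finite-F4 : Finite F4
finite-F4 = finite-× finite-Bool finite-Bool

-- ω ↦ 1 + x + x³ + x⁴ + x⁵, a root of y² + y + 1 in F64.
ι : F4 → F64
ι (a , b) = scale a 1F +F scale b (true ∷ true ∷ false ∷ true ∷ true ∷ true ∷ [])

opaque
  ι-+ : ∀ α β → ι (α +₄ β) ≡ ι α +F ι β
  ι-+ = from-yes (all? finite-F4 λ α → all? finite-F4 λ β → ι (α +₄ β) ≟F ι α +F ι β)

  ι-* : ∀ α β → ι (α *₄ β) ≡ ι α *F ι β
  ι-* = from-yes (all? finite-F4 λ α → all? finite-F4 λ β → ι (α *₄ β) ≟F ι α *F ι β)

  ι-nonzero : ∀ α → α ≢ 0₄ → ι α ≢ 0F
  ι-nonzero = from-yes (all? finite-F4 λ α → ¬? (α ≟₄ 0₄) →-dec ¬? (ι α ≟F 0F))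

F4² : Set
F4² = F4 × F4

0² : F4²
0² = 0₄ , 0₄

infixl 6 _+²_
infixr 7 _∙_ _•²_

_+²_ : F4² → F4² → F4²
(α , β) +² (γ , δ) = α +₄ γ , β +₄ δ

_∙_ : F4 → F4² → F4²
γ ∙ (α , β) = γ *₄ α , γ *₄ β

_•²_ : Bool → F4² → F4²
e •² ζ = if e then ζ else 0²

infix 4 _≟²_
_≟²_ : DecidableEquality F4²
_≟²_ = ×-≡-dec _≟₄_ _≟₄_

finite-F4² : Finite F4²
finite-F4² = finite-× finite-F4 finite-F4

lincomb² : F4² → F4² → F4² → F4²
lincomb² c₁ c₂ (α , β) = α ∙ c₁ +² β ∙ c₂

Spanning : F4² → F4² → Set
Spanning c₁ c₂ = ∀ ζ → ∃ λ d → lincomb² c₁ c₂ d ≡ ζ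

Independent² : F4² → F4² → Set
Independent² c₁ c₂ = c₁ ≢ 0² × ∀ α → c₂ ≢ α ∙ c₁

spanning? : ∀ c₁ c₂ → Dec (Spanning c₁ c₂)
spanning? c₁ c₂ = all? finite-F4² λ ζ → any? finite-F4² λ d → lincomb² c₁ c₂ d ≟² ζ

independent²? : ∀ c₁ c₂ → Dec (Independent² c₁ c₂)
independent²? c₁ c₂ = ¬? (c₁ ≟² 0²) ×-dec all? finite-F4 λ α → ¬? (c₂ ≟² α ∙ c₁)

opaque
  independent⇒spanning : ∀ c₁ c₂ → Independent² c₁ c₂ → Spanning c₁ c₂
  independent⇒spanning = from-yes (all? finite-F4² λ c₁ → all? finite-F4² λ c₂ →
    independent²? c₁ c₂ →-dec spanning? c₁ c₂)

  x+²y≡0⇒x≡y : ∀ c d → c +² d ≡ 0² → c ≡ d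
  x+²y≡0⇒x≡y = from-yes (all? finite-F4² λ c → all? finite-F4² λ d → (c +² d ≟² 0²) →-dec (c ≟² d))

_∈⟨_,_⟩² : F4² → F4² → F4² → Set
ζ ∈⟨ p , q ⟩² = (ζ ≡ 0²) ⊎ (ζ ≡ p) ⊎ (ζ ≡ q) ⊎ (ζ ≡ p +² q)

SameSpan² : F4² × F4² → F4² × F4² → Set
SameSpan² (p , q) (p′ , q′) = ∀ ζ → (ζ ∈⟨ p , q ⟩² → ζ ∈⟨ p′ , q′ ⟩²) × (ζ ∈⟨ p′ , q′ ⟩² → ζ ∈⟨ p , q ⟩²)

LinIndep3² : F4² → F4² → F4² → Set
LinIndep3² p q r = ∀ e₁ e₂ e₃ → (e₁ •² p) +² (e₂ •² q) +² (e₃ •² r) ≡ 0² →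
                     (e₁ ≡ false) × (e₂ ≡ false) × (e₃ ≡ false)

∈⟨_,_⟩²? : ∀ p q ζ → Dec (ζ ∈⟨ p , q ⟩²)
∈⟨ p , q ⟩²? ζ = (ζ ≟² 0²) ⊎-dec (ζ ≟² p) ⊎-dec (ζ ≟² q) ⊎-dec (ζ ≟² p +² q)

sameSpan²? : ∀ σ τ → Dec (SameSpan² σ τ)
sameSpan²? (p , q) (p′ , q′) = all? finite-F4² λ ζ →
  (∈⟨ p , q ⟩²? ζ →-dec ∈⟨ p′ , q′ ⟩²? ζ) ×-dec (∈⟨ p′ , q′ ⟩²? ζ →-dec ∈⟨ p , q ⟩²? ζ)

linIndep3²? : ∀ p q r → Dec (LinIndep3² p q r)
linIndep3²? p q r = all? finite-Bool λ e₁ → all? finite-Bool λ e₂ → all? finite-Bool λ e₃ →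
  ((e₁ •² p) +² (e₂ •² q) +² (e₃ •² r) ≟² 0²) →-dec ((e₁ ≟B false) ×-dec (e₂ ≟B false) ×-dec (e₃ ≟B false))

Triple : Set → Set
Triple A = A × A × A

data Side : Set where
  ab bc ca : Side

side : ∀ {A : Set} → Side → Triple A → A × A
side ab (a , b , c) = a , b
side bc (a , b , c) = b , c
side ca (a , b , c) = c , a

finite-Side : Finite Side
finite-Side = record
  { elements = ab ∷ bc ∷ ca ∷ []
  ; complete = λ { ab → here refl ; bc → there (here refl) ; ca → there (there (here refl)) }
  }

mapTriple : ∀ {A B : Set} → (A → B) → Triple A → Triple B
mapTriple f (a , b , c) = f a , f b , f c

side-map : ∀ {A B : Set} (f : A → B) s t → side s (mapTriple f t) ≡ map f f (side s t)
side-map f ab t = refl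
side-map f bc t = refl
side-map f ca t = refl

-- The blocks of a group divisible triangle design on F4² over F2 whose groups are the five
-- F4-lines.
baseTriangles : Vec (Triple F4²) 10
baseTriangles =
    ((1₄ , 0₄) , (0₄ , 1₄) , (ω  , ω ))
  ∷ ((ω  , 0₄) , (1₄ , 1₄) , (ω² , ω ))
  ∷ ((ω  , 0₄) , (0₄ , 1₄) , (1₄ , ω²))
  ∷ ((ω  , 0₄) , (0₄ , ω ) , (ω  , ω²))
  ∷ ((1₄ , 0₄) , (0₄ , ω ) , (1₄ , ω²))
  ∷ ((ω² , 0₄) , (ω  , ω ) , (1₄ , ω²))
  ∷ ((1₄ , 0₄) , (ω  , 1₄) , (ω² , ω²))
  ∷ ((1₄ , 1₄) , (ω  , 1₄) , (0₄ , ω²))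
  ∷ ((ω² , 0₄) , (ω² , 1₄) , (0₄ , ω ))
  ∷ ((ω² , ω ) , (0₄ , ω²) , (ω² , ω²))
  ∷ []

baseTriangle : Fin 10 → Triple F4²
baseTriangle = Vec.lookup baseTriangles

opaque
  baseTriangle-sides-spanning : ∀ i s → uncurry Spanning (side s (baseTriangle i))
  baseTriangle-sides-spanning = from-yes (all? (finite-Fin 10) λ i → all? finite-Side λ s →
    uncurry spanning? (side s (baseTriangle i)))

  baseTriangle-linIndep : ∀ i → let (p , q , r) = baseTriangle i in LinIndep3² p q r
  baseTriangle-linIndep = from-yes (all? (finite-Fin 10) λ i → let (p , q , r) = baseTriangle i in linIndep3²? p q r)

  baseTriangles-cover : ∀ ξ η → Independent² ξ η → ∃₂ λ i s → SameSpan² (side s (baseTriangle i)) (ξ , η)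
  baseTriangles-cover = from-yes (all? finite-F4² λ ξ → all? finite-F4² λ η → independent²? ξ η →-dec
    any? (finite-Fin 10) λ i → any? finite-Side λ s → sameSpan²? (side s (baseTriangle i)) (ξ , η))

  baseTriangles-disjoint : ∀ i j s t → SameSpan² (side s (baseTriangle i)) (side t (baseTriangle j)) → i ≡ j
  baseTriangles-disjoint = from-yes (all? (finite-Fin 10) λ i → all? (finite-Fin 10) λ j →
    all? finite-Side λ s → all? finite-Side λ t →
    sameSpan²? (side s (baseTriangle i)) (side t (baseTriangle j)) →-dec (i ≟Fin j))

∈Group-refl : (v : V k) → v ∈Group v
∈Group-refl v = 1F , sym (·-identityˡ v)

0V-∈Group : (v : V k) → 0V ∈Group v
0V-∈Group v = 0F , sym (·-zeroˡ v)

∈Group-⊕ : x ∈Group v → y ∈Group v → (x ⊕ y) ∈Group v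
∈Group-⊕ {v = v} (l , refl) (m , refl) = l +F m , sym (·-distribʳ l m v)

∈Group-· : ∀ l → x ∈Group v → (l · x) ∈Group v
∈Group-· {v = v} l (m , refl) = l *F m , sym (·-assoc l m v)

∈Group-trans : x ∈Group y → y ∈Group w → x ∈Group w
∈Group-trans (l , refl) y∈w = ∈Group-· l y∈w

∈Group-cancel : l ≢ 0F → (l · x) ∈Group v → x ∈Group v
∈Group-cancel {l = l} {x = x} l≢0 lx∈v with *F-inverse l l≢0
... | m , ml≡1 = subst (_∈Group _) m·lx≡x (∈Group-· m lx∈v)
  where
  m·lx≡x : m · (l · x) ≡ x
  m·lx≡x = begin
    m · (l · x)   ≡⟨ sym (·-assoc m l x) ⟩
    (m *F l) · x  ≡⟨ cong (_· x) ml≡1 ⟩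
    1F · x        ≡⟨ ·-identityˡ x ⟩
    x             ∎
    where open ≡-Reasoning

∈Group-sym : x ∈Group v → x ≢ 0V → v ∈Group x
∈Group-sym {x = x} {v = v} (l , x≡lv) x≢0 = ∈Group-cancel l≢0 (subst (_∈Group x) x≡lv (∈Group-refl x))
  where
  l≢0 : l ≢ 0F
  l≢0 refl = x≢0 (trans x≡lv (·-zeroˡ v))

Independent : V k → V k → Set
Independent x y = x ≢ 0V × ¬ (y ∈Group x)

infix 4 _∈Group?_

opaque
  _∈Group?_ : (x v : V k) → Dec (x ∈Group v)
  x ∈Group? v = any? finite-F64 λ l → x ≟V l · v

  independent? : (x y : V k) → Dec (Independent x y)
  independent? x y = ¬? (x ≟V 0V) ×-dec ¬? (y ∈Group? x)

independent-not-cogroup : Independent x y → x ∈Group w → y ∈Group w → ⊥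
independent-not-cogroup (x≢0 , y∉x) x∈w y∈w = y∉x (∈Group-trans y∈w (∈Group-sym x∈w x≢0))

independent⇒¬InGroup : Independent x y → ¬ InGroup x y
independent⇒¬InGroup ind (w , _ , span⊆w) =
  independent-not-cogroup ind (span⊆w _ (inj₂ (inj₁ refl))) (span⊆w _ (inj₂ (inj₂ (inj₁ refl))))

∈Group⇒InGroup : x ≢ 0V → y ∈Group x → InGroup x y
∈Group⇒InGroup {x = x} {y = y} x≢0 y∈x = x , x≢0 , span⊆x
  where
  span⊆x : ∀ z → z ∈⟨ x , y ⟩ → z ∈Group x
  span⊆x z (inj₁ refl)               = 0V-∈Group x
  span⊆x z (inj₂ (inj₁ refl))        = ∈Group-refl x
  span⊆x z (inj₂ (inj₂ (inj₁ refl))) = y∈x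
  span⊆x z (inj₂ (inj₂ (inj₂ refl))) = ∈Group-⊕ (∈Group-refl x) y∈x

InGroup-resp-SameSpan : SameSpan u v x y → InGroup x y → InGroup u v
InGroup-resp-SameSpan same (w , w≢0 , span⊆w) = w , w≢0 , λ z z∈uv → span⊆w z (proj₁ (same z) z∈uv)

-- F4-planes and their canonical bases

infixr 7 _⊙_
_⊙_ : F4 → V k → V k
α ⊙ v = ι α · v

⊙-+ : ∀ α β (v : V k) → (α +₄ β) ⊙ v ≡ (α ⊙ v) ⊕ (β ⊙ v)
⊙-+ α β v = trans (cong (_· v) (ι-+ α β)) (·-distribʳ (ι α) (ι β) v)

⊙-* : ∀ α β (v : V k) → (α *₄ β) ⊙ v ≡ α ⊙ (β ⊙ v)
⊙-* α β v = trans (cong (_· v) (ι-* α β)) (·-assoc (ι α) (ι β) v)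

-- Opaque, so that unification treats lincomb u v as rigid; this block is its interface.
opaque
  lincomb : V k → V k → F4² → V k
  lincomb u v (α , β) = (α ⊙ u) ⊕ (β ⊙ v)

  lincomb-0² : (u v : V k) → lincomb u v 0² ≡ 0V
  lincomb-0² u v = trans (cong₂ _⊕_ (·-zeroˡ u) (·-zeroˡ v)) (⊕-self 0V)

  lincomb-e₁ : (u v : V k) → lincomb u v (1₄ , 0₄) ≡ u
  lincomb-e₁ u v = trans (cong₂ _⊕_ (·-identityˡ u) (·-zeroˡ v)) (⊕-identityʳ u)

  lincomb-e₂ : (u v : V k) → lincomb u v (0₄ , 1₄) ≡ v
  lincomb-e₂ u v = trans (cong₂ _⊕_ (·-zeroˡ u) (·-identityˡ v)) (⊕-identityˡ v)

  lincomb-+² : (u v : V k) (c d : F4²) → lincomb u v c ⊕ lincomb u v d ≡ lincomb u v (c +² d)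
  lincomb-+² u v (α , β) (γ , δ) = begin
    ((α ⊙ u) ⊕ (β ⊙ v)) ⊕ ((γ ⊙ u) ⊕ (δ ⊙ v))  ≡⟨ ⊕-interchange _ _ _ _ ⟩
    ((α ⊙ u) ⊕ (γ ⊙ u)) ⊕ ((β ⊙ v) ⊕ (δ ⊙ v))  ≡⟨ sym (cong₂ _⊕_ (⊙-+ α γ u) (⊙-+ β δ v)) ⟩
    ((α +₄ γ) ⊙ u) ⊕ ((β +₄ δ) ⊙ v)            ∎
    where open ≡-Reasoning

  lincomb-∙ : (u v : V k) (γ : F4) (c : F4²) → γ ⊙ lincomb u v c ≡ lincomb u v (γ ∙ c)
  lincomb-∙ u v γ (α , β) = begin
    γ ⊙ ((α ⊙ u) ⊕ (β ⊙ v))              ≡⟨ ·-distribˡ (ι γ) (α ⊙ u) (β ⊙ v) ⟩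
    (γ ⊙ (α ⊙ u)) ⊕ (γ ⊙ (β ⊙ v))        ≡⟨ sym (cong₂ _⊕_ (⊙-* γ α u) (⊙-* γ β v)) ⟩
    ((γ *₄ α) ⊙ u) ⊕ ((γ *₄ β) ⊙ v)      ∎
    where open ≡-Reasoning

  lincomb-• : (u v : V k) (e : Bool) (c : F4²) → e • lincomb u v c ≡ lincomb u v (e •² c)
  lincomb-• u v true  c = refl
  lincomb-• u v false c = sym (lincomb-0² u v)

  lincomb-lincomb : (u v : V k) (c₁ c₂ d : F4²) →
                    lincomb (lincomb u v c₁) (lincomb u v c₂) d ≡ lincomb u v (lincomb² c₁ c₂ d)
  lincomb-lincomb u v c₁ c₂ (α , β) =
    trans (cong₂ _⊕_ (lincomb-∙ u v α c₁) (lincomb-∙ u v β c₂)) (lincomb-+² u v (α ∙ c₁) (β ∙ c₂))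

  lincomb-∈Group : u ∈Group w → v ∈Group w → ∀ c → lincomb u v c ∈Group w
  lincomb-∈Group u∈w v∈w (α , β) = ∈Group-⊕ (∈Group-· (ι α) u∈w) (∈Group-· (ι β) v∈w)

  -- αu + βv = 0 means αu = βv, so a nonzero coefficient would put u and v into one group.
  lincomb-zero : Independent u v → ∀ c → lincomb u v c ≡ 0V → c ≡ 0²
  lincomb-zero {u = u} {v = v} ind (α , β) αu+βv≡0 with β ≟₄ 0₄ | α ≟₄ 0₄
  ... | no β≢0   | _        = ⊥-elim (independent-not-cogroup ind (∈Group-refl u) (∈Group-cancel (ι-nonzero β β≢0) βv∈u))
    where
    βv∈u : (β ⊙ v) ∈Group u
    βv∈u = subst (_∈Group u) (x⊕y≡0⇒x≡y _ _ αu+βv≡0) (∈Group-· (ι α) (∈Group-refl u))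
  ... | yes refl | no α≢0   = ⊥-elim (independent-not-cogroup ind (∈Group-cancel (ι-nonzero α α≢0) αu∈v) (∈Group-refl v))
    where
    αu∈v : (α ⊙ u) ∈Group v
    αu∈v = subst (_∈Group v) (sym (x⊕y≡0⇒x≡y _ _ αu+βv≡0)) (∈Group-· 0F (∈Group-refl v))
  ... | yes refl | yes refl = refl

lincomb-injective : Independent u v → ∀ c d → lincomb u v c ≡ lincomb u v d → c ≡ d
lincomb-injective {u = u} {v = v} ind c d eq = x+²y≡0⇒x≡y c d (lincomb-zero ind (c +² d) (begin
  lincomb u v (c +² d)                 ≡⟨ sym (lincomb-+² u v c d) ⟩
  lincomb u v c ⊕ lincomb u v d        ≡⟨ cong (_⊕ lincomb u v d) eq ⟩
  lincomb u v d ⊕ lincomb u v d        ≡⟨ ⊕-self _ ⟩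
  0V                                   ∎))
  where open ≡-Reasoning

independent-coords : ∀ {c₁ c₂} → Independent (lincomb u v c₁) (lincomb u v c₂) → Independent² c₁ c₂
independent-coords {u = u} {v = v} {c₁} {c₂} (x≢0 , y∉x) = c₁≢0 , c₂≢αc₁
  where
  c₁≢0 : c₁ ≢ 0²
  c₁≢0 refl = x≢0 (lincomb-0² u v)
  c₂≢αc₁ : ∀ α → c₂ ≢ α ∙ c₁
  c₂≢αc₁ α refl = y∉x (subst (_∈Group _) (lincomb-∙ u v α c₁) (∈Group-· (ι α) (∈Group-refl _)))

Span₄ : V k → V k → V k → Set
Span₄ u v z = ∃ λ c → lincomb u v c ≡ z

opaque
  span₄? : (u v : V k) → Decidable (Span₄ u v)
  span₄? u v z = any? finite-F4² λ c → lincomb u v c ≟V z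

span-change : ∀ {c₁ c₂} → Spanning c₁ c₂ → Span₄ (lincomb u v c₁) (lincomb u v c₂) ≐ Span₄ u v
span-change {u = u} {v = v} {c₁} {c₂} spanning = narrow , widen
  where
  narrow : Span₄ (lincomb u v c₁) (lincomb u v c₂) ⊆ Span₄ u v
  narrow (d , refl) = lincomb² c₁ c₂ d , sym (lincomb-lincomb u v c₁ c₂ d)
  widen : Span₄ u v ⊆ Span₄ (lincomb u v c₁) (lincomb u v c₂)
  widen (ζ , refl) with spanning ζ
  ... | d , refl = d , lincomb-lincomb u v c₁ c₂ d

independent-of-span : Independent x y → Span₄ u v x → Span₄ u v y → Independent u v
independent-of-span {u = u} {v = v} ind (c , refl) (d , refl) = u≢0 , v∉u
  where
  not-cogroup : u ∈Group w → v ∈Group w → ⊥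
  not-cogroup u∈w v∈w = independent-not-cogroup ind (lincomb-∈Group u∈w v∈w c) (lincomb-∈Group u∈w v∈w d)
  u≢0 : u ≢ 0V
  u≢0 refl = not-cogroup (0V-∈Group v) (∈Group-refl v)
  v∉u : ¬ v ∈Group u
  v∉u = not-cogroup (∈Group-refl u)

independent-image : Independent u v → ∀ {c₁ c₂} → Spanning c₁ c₂ → Independent (lincomb u v c₁) (lincomb u v c₂)
independent-image {u = u} {v = v} ind spanning = independent-of-span ind
  (proj₂ (span-change spanning) ((1₄ , 0₄) , lincomb-e₁ u v))
  (proj₂ (span-change spanning) ((0₄ , 1₄) , lincomb-e₂ u v))

independent-span : Independent x y → Span₄ u v x → Span₄ u v y → Span₄ x y ≐ Span₄ u v
independent-span {u = u} {v = v} ind (ξ , refl) (η , refl) =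
  span-change (independent⇒spanning ξ η (independent-coords {u = u} {v = v} ind))

opaque
  finite-V : ∀ k → Finite (V k)
  finite-V = finite-Vec finite-F64

  finite-V-unique : ∀ k → Unique (elements (finite-V k))
  finite-V-unique = vectors-unique (vectors-unique (((λ ()) All.∷ All.[]) ∷ All.[] ∷ []) 6)

  -- The first element of S in a fixed enumeration of V, or 0V if there is none.
  first : {S : V k → Set} → Decidable S → V k
  first {k} S? = fromMaybe 0V (find S? (elements (finite-V k)))

  first-satisfies : {S : V k → Set} (S? : Decidable S) → S x → S (first S?)
  first-satisfies {x = x} S? Sx = find-satisfies S? 0V (complete (finite-V _) x) Sx

  first-cong : {S S′ : V k → Set} (S? : Decidable S) (S′? : Decidable S′) → S ≐ S′ → first S? ≡ first S′?
  first-cong {k} S? S′? S≐S′ = cong (fromMaybe 0V) (find-cong S? S′? S≐S′ (elements (finite-V k)))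

firstNonzero : {S : V k → Set} → Decidable S → V k
firstNonzero S? = first (S? ∩? ∁? (_≟V 0V))

independentPair : {S : V k → Set} → Decidable S → V k × V k
independentPair S? = firstNonzero S? , first (S? ∩? ∁? (_∈Group? firstNonzero S?))

independentPair-cong : {S S′ : V k → Set} (S? : Decidable S) (S′? : Decidable S′) → S ≐ S′ → independentPair S? ≡ independentPair S′?
independentPair-cong S? S′? S≐S′ = cong₂ _,_ first≡ (begin
  first (S?  ∩? ∁? (_∈Group? firstNonzero S?))   ≡⟨ first-cong _ _ (∩-congˡ S≐S′) ⟩
  first (S′? ∩? ∁? (_∈Group? firstNonzero S?))   ≡⟨ cong (λ u → first (S′? ∩? ∁? (_∈Group? u))) first≡ ⟩
  first (S′? ∩? ∁? (_∈Group? firstNonzero S′?))  ∎)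
  where
  open ≡-Reasoning
  first≡ : firstNonzero S? ≡ firstNonzero S′?
  first≡ = first-cong _ _ (∩-congˡ S≐S′)

IndependentPairIn : (V k → Set) → V k × V k → Set
IndependentPairIn S (u , v) = S u × S v × Independent u v

independentPair-spec : {S : V k → Set} (S? : Decidable S) → Independent x y → S x → S y → IndependentPairIn S (independentPair S?)
independentPair-spec {x = x} {y = y} {S = S} S? ind@(x≢0 , _) Sx Sy =
  proj₁ first-spec , proj₁ second-spec , proj₂ first-spec , proj₂ second-spec
  where
  first-spec = first-satisfies (S? ∩? ∁? (_≟V 0V)) (Sx , x≢0)
  outside : ∃ λ z → S z × ¬ z ∈Group firstNonzero S?
  outside with x ∈Group? firstNonzero S?
  ... | no x∉  = x , Sx , x∉
  ... | yes x∈ = y , Sy , independent-not-cogroup ind x∈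
  second-spec = first-satisfies (S? ∩? ∁? (_∈Group? firstNonzero S?)) (proj₂ outside)

canonicalBasis : V k → V k → V k × V k
canonicalBasis x y = independentPair (span₄? x y)

canonicalBasis-cong : ∀ {x′ y′ : V k} → Span₄ x y ≐ Span₄ x′ y′ → canonicalBasis x y ≡ canonicalBasis x′ y′
canonicalBasis-cong = independentPair-cong (span₄? _ _) (span₄? _ _)

canonicalBasis-spec : Independent x y → uncurry Independent (canonicalBasis x y) × uncurry Span₄ (canonicalBasis x y) ≐ Span₄ x y
canonicalBasis-spec {x = x} {y = y} ind with independentPair-spec (span₄? x y) ind ((1₄ , 0₄) , lincomb-e₁ x y) ((0₄ , 1₄) , lincomb-e₂ x y)
... | u∈xy , v∈xy , ind-uv = ind-uv , independent-span ind-uv u∈xy v∈xy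

-- Blocks

private
  variable
    p q p′ q′ : F4²

sameSpan-sym : ∀ {a b c d : V k} → SameSpan a b c d → SameSpan c d a b
sameSpan-sym same z = swap (same z)

sameSpan-trans : ∀ {a b c d e f : V k} → SameSpan a b c d → SameSpan c d e f → SameSpan a b e f
sameSpan-trans same same′ z = (λ z∈ → proj₁ (same′ z) (proj₁ (same z) z∈)) , (λ z∈ → proj₂ (same z) (proj₂ (same′ z) z∈))

span²⇒span : ∀ {ζ} → ζ ∈⟨ p , q ⟩² → lincomb u v ζ ∈⟨ lincomb u v p , lincomb u v q ⟩
span²⇒span {u = u} {v = v} (inj₁ refl)               = inj₁ (lincomb-0² u v)
span²⇒span                 (inj₂ (inj₁ refl))        = inj₂ (inj₁ refl)
span²⇒span                 (inj₂ (inj₂ (inj₁ refl))) = inj₂ (inj₂ (inj₁ refl))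
span²⇒span {p = p} {q = q} {u = u} {v = v} (inj₂ (inj₂ (inj₂ refl))) = inj₂ (inj₂ (inj₂ (sym (lincomb-+² u v p q))))

span⇒span² : ∀ {z} → z ∈⟨ lincomb u v p , lincomb u v q ⟩ → ∃ λ ζ → lincomb u v ζ ≡ z × ζ ∈⟨ p , q ⟩²
span⇒span² {u = u} {v = v} (inj₁ refl)       = 0² , lincomb-0² u v , inj₁ refl
span⇒span² {p = p} (inj₂ (inj₁ refl))        = p , refl , inj₂ (inj₁ refl)
span⇒span² {q = q} (inj₂ (inj₂ (inj₁ refl))) = q , refl , inj₂ (inj₂ (inj₁ refl))
span⇒span² {u = u} {v = v} {p = p} {q = q} (inj₂ (inj₂ (inj₂ refl))) =
  p +² q , sym (lincomb-+² u v p q) , inj₂ (inj₂ (inj₂ refl))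

span⊆span₄ : ∀ {z} → z ∈⟨ lincomb u v p , lincomb u v q ⟩ → Span₄ u v z
span⊆span₄ z∈ = let (ζ , eq , _) = span⇒span² z∈ in ζ , eq

sameSpan²⇒sameSpan : SameSpan² (p , q) (p′ , q′) →
  SameSpan (lincomb u v p) (lincomb u v q) (lincomb u v p′) (lincomb u v q′)
sameSpan²⇒sameSpan {p = p} {q = q} {p′ = p′} {q′ = q′} {u = u} {v = v} same z =
  transfer (proj₁ ∘ same) , transfer (proj₂ ∘ same)
  where
  transfer : ∀ {p q p′ q′} → (∀ ζ → ζ ∈⟨ p , q ⟩² → ζ ∈⟨ p′ , q′ ⟩²) →
             z ∈⟨ lincomb u v p , lincomb u v q ⟩ → z ∈⟨ lincomb u v p′ , lincomb u v q′ ⟩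
  transfer {p} {q} {p′} {q′} ⊆ z∈ with span⇒span² z∈
  ... | ζ , refl , ζ∈ = span²⇒span (⊆ ζ ζ∈)

sameSpan⇒sameSpan² : Independent u v → SameSpan (lincomb u v p) (lincomb u v q) (lincomb u v p′) (lincomb u v q′) →
  SameSpan² (p , q) (p′ , q′)
sameSpan⇒sameSpan² {u = u} {v = v} {p = p} {q = q} {p′ = p′} {q′ = q′} ind same ζ =
  transfer (proj₁ (same (lincomb u v ζ))) ,
  transfer (proj₂ (same (lincomb u v ζ)))
  where
  transfer : ∀ {p q p′ q′} → (lincomb u v ζ ∈⟨ lincomb u v p , lincomb u v q ⟩ → lincomb u v ζ ∈⟨ lincomb u v p′ , lincomb u v q′ ⟩) →
             ζ ∈⟨ p , q ⟩² → ζ ∈⟨ p′ , q′ ⟩²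
  transfer {p} {q} {p′} {q′} ⊆ ζ∈ with span⇒span² (⊆ (span²⇒span ζ∈))
  ... | ζ′ , eq , ζ′∈ = subst (_∈⟨ p′ , q′ ⟩²) (lincomb-injective ind ζ′ ζ eq) ζ′∈

linIndep3²⇒linIndep3 : Independent u v → ∀ {p q r} → LinIndep3² p q r → LinIndep3 (lincomb u v p) (lincomb u v q) (lincomb u v r)
linIndep3²⇒linIndep3 {u = u} {v = v} ind {p} {q} {r} indep e₁ e₂ e₃ sum≡0 =
  indep e₁ e₂ e₃ (lincomb-zero ind _ (trans (sym sum≡) sum≡0))
  where
  open ≡-Reasoning
  sum≡ : ((e₁ • lincomb u v p) ⊕ (e₂ • lincomb u v q)) ⊕ (e₃ • lincomb u v r) ≡ lincomb u v ((e₁ •² p) +² (e₂ •² q) +² (e₃ •² r))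
  sum≡ = begin
    ((e₁ • lincomb u v p) ⊕ (e₂ • lincomb u v q)) ⊕ (e₃ • lincomb u v r)
      ≡⟨ cong₂ _⊕_ (cong₂ _⊕_ (lincomb-• u v e₁ p) (lincomb-• u v e₂ q)) (lincomb-• u v e₃ r) ⟩
    (lincomb u v (e₁ •² p) ⊕ lincomb u v (e₂ •² q)) ⊕ lincomb u v (e₃ •² r)
      ≡⟨ cong (_⊕ lincomb u v (e₃ •² r)) (lincomb-+² u v (e₁ •² p) (e₂ •² q)) ⟩
    lincomb u v ((e₁ •² p) +² (e₂ •² q)) ⊕ lincomb u v (e₃ •² r)
      ≡⟨ lincomb-+² u v _ _ ⟩
    lincomb u v ((e₁ •² p) +² (e₂ •² q) +² (e₃ •² r))  ∎

independent-side-span : Independent x y → SameSpan (lincomb u v p) (lincomb u v q) x y → Span₄ x y ≐ Span₄ u v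
independent-side-span ind same =
  independent-span ind (span⊆span₄ (proj₂ (same _) (inj₂ (inj₁ refl)))) (span⊆span₄ (proj₂ (same _) (inj₂ (inj₂ (inj₁ refl)))))

IsCanonical : V k × V k → Set
IsCanonical w = uncurry canonicalBasis w ≡ w

embed : V k × V k → Triple F4² → Triple (V k)
embed w = mapTriple (uncurry lincomb w)

-- IsCanonical makes each F4-plane contribute its ten triangles only once.
IsBlock : Triple (V k) → Set
IsBlock {k} t = ∃₂ λ (w : V k × V k) i → uncurry Independent w × IsCanonical w × t ≡ embed w (baseTriangle i)

opaque
  isBlock? : (t : Triple (V k)) → Dec (IsBlock t)
  isBlock? {k} t = map′ (λ ((w , i) , b) → w , i , b) (λ (w , i , b) → (w , i) , b)
    (any? (finite-× (finite-× (finite-V k) (finite-V k)) (finite-Fin 10)) λ (w , i) →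
      uncurry independent? w ×-dec ×-≡-dec _≟V_ _≟V_ (uncurry canonicalBasis w) w
                      ×-dec ×-≡-dec _≟V_ (×-≡-dec _≟V_ _≟V_) t (embed w (baseTriangle i)))

block-linIndep : ∀ {p q r : V k} → IsBlock (p , q , r) → LinIndep3 p q r
block-linIndep (w , i , ind , _ , refl) = linIndep3²⇒linIndep3 ind (baseTriangle-linIndep i)

module _ (P : V k → V k → Set) {w : V k × V k} (s : Side) (t : Triple F4²) where

  embed-side⁺ : uncurry P (map (uncurry lincomb w) (uncurry lincomb w) (side s t)) → uncurry P (side s (embed w t))
  embed-side⁺ = subst (uncurry P) (sym (side-map (uncurry lincomb w) s t))

  embed-side⁻ : uncurry P (side s (embed w t)) → uncurry P (map (uncurry lincomb w) (uncurry lincomb w) (side s t))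
  embed-side⁻ = subst (uncurry P) (side-map (uncurry lincomb w) s t)

block-sides-independent : ∀ {t : Triple (V k)} → IsBlock t → ∀ s → uncurry Independent (side s t)
block-sides-independent (w , i , ind , _ , refl) s =
  embed-side⁺ Independent s (baseTriangle i) (independent-image ind (baseTriangle-sides-spanning i s))

canonical-side : ∀ {w : V k × V k} → IsCanonical w → Independent x y →
                 SameSpan (uncurry lincomb w p) (uncurry lincomb w q) x y → canonicalBasis x y ≡ w
canonical-side canonical ind same = trans (canonicalBasis-cong (independent-side-span ind same)) canonical

block-unique : ∀ {t t′ : Triple (V k)} {s s′} → Independent x y → IsBlock t → IsBlock t′ →
               uncurry SameSpan (side s t) x y → uncurry SameSpan (side s′ t′) x y → t ≡ t′
block-unique {x = x} {y = y} {s = s} {s′ = s′} ind-xy (w , i , ind , canonical , refl) (w′ , j , _ , canonical′ , refl) same same′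
  with embed-side⁻ (λ a b → SameSpan a b x y) s (baseTriangle i) same
     | embed-side⁻ (λ a b → SameSpan a b x y) s′ (baseTriangle j) same′
... | side≈xy | side′≈xy with trans (sym (canonical-side canonical ind-xy side≈xy)) (canonical-side canonical′ ind-xy side′≈xy)
... | refl with baseTriangles-disjoint i j s s′ (sameSpan⇒sameSpan² ind (sameSpan-trans side≈xy (sameSpan-sym side′≈xy)))
... | refl = refl

block-exists : Independent x y → ∃₂ λ (t : Triple (V k)) s → IsBlock t × uncurry SameSpan (side s t) x y
block-exists {x = x} {y = y} ind-xy with canonicalBasis-spec ind-xy
... | ind-w , w≐xy with proj₂ w≐xy ((1₄ , 0₄) , lincomb-e₁ x y) | proj₂ w≐xy ((0₄ , 1₄) , lincomb-e₂ x y)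
... | ξ , ξ↦x | η , η↦y with baseTriangles-cover ξ η (independent-coords (subst₂ Independent (sym ξ↦x) (sym η↦y) ind-xy))
... | i , s , same² = embed basis (baseTriangle i) , s , (basis , i , ind-w , canonicalBasis-cong w≐xy , refl) ,
  embed-side⁺ (λ a b → SameSpan a b x y) s (baseTriangle i) (subst₂ (SameSpan _ _) ξ↦x η↦y (sameSpan²⇒sameSpan same²))
  where basis = canonicalBasis x y

vertices : Triangle k → Triple (V k)
vertices T = a T , b T , c T

toTriangle : (t : Triple (V k)) → IsBlock t → Triangle k
toTriangle (p , q , r) block = triangle p q r (block-linIndep block)

module Blocks (k : ℕ) = Collect (isBlock? {k}) vertices toTriangle (λ _ _ → refl)

triples : ∀ k → Finite (Triple (V k))
triples k = finite-× (finite-V k) (finite-× (finite-V k) (finite-V k))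

opaque
  blocks : ∀ k → List (Triangle k)
  blocks k = Blocks.collect k (elements (triples k))

  blocks-sound : ∀ j → IsBlock (vertices (lookup (blocks k) j))
  blocks-sound {k} j = proj₂ (Blocks.collect-sound k (elements (triples k)) j)

  blocks-complete : ∀ {t : Triple (V k)} → IsBlock t → ∃ λ i → vertices (lookup (blocks k) i) ≡ t
  blocks-complete {k} {t} = Blocks.collect-complete k (complete (triples k) t)

  blocks-injective : ∀ i j → vertices (lookup (blocks k) i) ≡ vertices (lookup (blocks k) j) → i ≡ j
  blocks-injective {k} = Blocks.collect-injective k
    (cartesianProduct⁺ (finite-V-unique k) (cartesianProduct⁺ (finite-V-unique k) (finite-V-unique k)))

hasSide⇒side : ∀ {T : Triangle k} → HasSide T x y → ∃ λ s → uncurry SameSpan (side s (vertices T)) x y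
hasSide⇒side (inj₁ same)        = ab , same
hasSide⇒side (inj₂ (inj₁ same)) = bc , same
hasSide⇒side (inj₂ (inj₂ same)) = ca , same

side⇒hasSide : ∀ {T : Triangle k} s → uncurry SameSpan (side s (vertices T)) x y → HasSide T x y
side⇒hasSide ab same = inj₁ same
side⇒hasSide bc same = inj₂ (inj₁ same)
side⇒hasSide ca same = inj₂ (inj₂ same)

inGroup⇒noSide : InGroup x y → NoneOf (blocks k) (λ T → HasSide T x y)
inGroup⇒noSide {k = k} inGroup j hasSide with hasSide⇒side {T = lookup (blocks k) j} hasSide
... | s , same = independent⇒¬InGroup (block-sides-independent (blocks-sound j) s) (InGroup-resp-SameSpan same inGroup)

independent⇒exactlyOneSide : Independent x y → ExactlyOne (blocks k) (λ T → HasSide T x y)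
independent⇒exactlyOneSide {k = k} {x = x} {y = y} ind = exactlyOne (block-exists ind)
  where
  exactlyOne : (∃₂ λ t s → IsBlock t × uncurry SameSpan (side s t) x y) → ExactlyOne (blocks k) (λ T → HasSide T x y)
  exactlyOne (t , s , block , same) = i , side⇒hasSide {T = lookup (blocks k) i} s same-i , unique
    where
    located = blocks-complete block
    i = proj₁ located
    same-i : uncurry SameSpan (side s (vertices (lookup (blocks k) i))) x y
    same-i = subst (λ t → uncurry SameSpan (side s t) x y) (sym (proj₂ located)) same
    unique : ∀ j → HasSide (lookup (blocks k) j) x y → j ≡ i
    unique j hasSide = let (s′ , same′) = hasSide⇒side {T = lookup (blocks k) j} hasSide in
      blocks-injective j i (trans (block-unique {s = s′} {s′ = s} ind (blocks-sound j) block same′ same) (sym (proj₂ located)))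

linIndep2⇒nonzero : LinIndep2 x y → x ≢ 0V
linIndep2⇒nonzero {x = x} indep x≡0 with indep true false (trans (⊕-identityʳ x) x≡0)
... | () , _

blocks-isGDTD : ∀ k → IsGDTD k (blocks k)
blocks-isGDTD k x y indep with y ∈Group? x
... | yes y∈x = inj₂ (∈Group⇒InGroup x≢0 y∈x , inGroup⇒noSide (∈Group⇒InGroup x≢0 y∈x))
  where x≢0 = linIndep2⇒nonzero indep
... | no y∉x  = inj₁ (independent⇒¬InGroup ind , independent⇒exactlyOneSide ind)
  where ind = linIndep2⇒nonzero indep , y∉x

-- The construction works for every k.
theorem8 : ∀ (k : ℕ) → 1 ≤ k → Σ (List (Triangle k)) (λ B → IsGDTD k B)
theorem8 k _ = blocks k , blocks-isGDTD k
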